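{- Let $d$ be a positive even integer, $M:=2^d$, $c:=1-\frac{3}{2M-2}$, $f(x_1,x_2):=x_1^2-c\,x_1-x_2$, and for $t\in\{0,1,\dots,M-1\}$ let $\vec x^{(t)}:=\frac{1}{M-1}\left(t,\ \frac{t^2}{M-1}-t\right)^\top\in\mathbb{R}^2$. Then for every $t\in\{0,1,\dots,M-2\}$ and every $k\in\mathbb{Z}$ with $0\le t+k\le M-1$, the direction $\vec x^{(t+k)}-\vec x^{(t)}$ is improving at $\vec x^{(t)}$, i.e. $\nabla f(\vec x^{(t)})^\top(\vec x^{(t+k)}-\vec x^{(t)})>0$, if and only if $k=1$. -}

module Defs where

open import Data.Nat as ℕ using (ℕ; suc; zero; _^_; _∸_; NonZero; >-nonZero; z<s; s≤s; z≤n)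
open import Data.Nat.Properties as ℕP using (^-monoʳ-<; *-monoʳ-<; m<n⇒0<n∸m)
open import Data.Integer as ℤ using (ℤ; +_)
open import Data.Rational using (ℚ; _/_; _+_; _*_; _-_; -_; _<_; 0ℚ; 1ℚ)
open import Data.Product using (_×_; _,_; proj₁; proj₂)

M : ℕ → ℕ
M d = 2 ^ d

1<M : (d : ℕ) → .{{NonZero d}} → 1 ℕ.< M d
1<M (suc e) = ^-monoʳ-< 2 (s≤s (s≤s z≤n)) {0} {suc e} z<s

M-1-nonZero : (d : ℕ) → .{{NonZero d}} → NonZero (M d ∸ 1)
M-1-nonZero d = >-nonZero (m<n⇒0<n∸m (1<M d))

2M-2-nonZero : (d : ℕ) → .{{NonZero d}} → NonZero (2 ℕ.* M d ∸ 2)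
2M-2-nonZero d = >-nonZero (m<n⇒0<n∸m (*-monoʳ-< 2 (1<M d)))

c : (d : ℕ) → .{{NonZero d}} → ℚ
c d = 1ℚ - (_/_ (+ 3) (2 ℕ.* M d ∸ 2) {{2M-2-nonZero d}})

invM-1 : (d : ℕ) → .{{NonZero d}} → ℚ
invM-1 d = _/_ (+ 1) (M d ∸ 1) {{M-1-nonZero d}}

ι : ℤ → ℚ
ι z = z / 1

f : (d : ℕ) → .{{NonZero d}} → ℚ × ℚ → ℚ
f d (x₁ , x₂) = x₁ * x₁ - c d * x₁ - x₂

∇f : (d : ℕ) → .{{NonZero d}} → ℚ × ℚ → ℚ × ℚ
∇f d (x₁ , x₂) = (ι (+ 2) * x₁ - c d , - 1ℚ)

x : (d : ℕ) → .{{NonZero d}} → ℤ → ℚ × ℚ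
x d t = (invM-1 d * ι t , invM-1 d * (ι t * ι t * invM-1 d - ι t))

_·_ : ℚ × ℚ → ℚ × ℚ → ℚ
(a₁ , a₂) · (b₁ , b₂) = a₁ * b₁ + a₂ * b₂

_−ᵥ_ : ℚ × ℚ → ℚ × ℚ → ℚ × ℚ
(a₁ , a₂) −ᵥ (b₁ , b₂) = (a₁ - b₁ , a₂ - b₂)

Improving : (d : ℕ) → .{{NonZero d}} → ℚ × ℚ → ℚ × ℚ → Set
Improving d p v = 0ℚ < ∇f d p · v

{-# OPTIONS --safe #-}
-- With a = 1/(M-1) the points x⁽ᵗ⁾ lie on a parabola, and since 2(1 - c) = 3a the
-- directional derivative along a chord collapses to
--   ∇f(x⁽ᵗ⁾)ᵀ(x⁽ᵗ⁺ᵏ⁾ - x⁽ᵗ⁾) = a² k (3 - 2k) / 2,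
-- independently of t, and the only integer with k (3 - 2k) > 0 is k = 1.
module Submission where

open import Defs
open import Data.Nat as ℕ using (ℕ; NonZero; _∸_; suc)
open import Data.Nat.Divisibility using (_∣_)
import Data.Nat.Properties as ℕP
open import Data.Integer as ℤ using (ℤ; +_; -[1+_])
import Data.Integer.Properties as ℤP
open import Data.Integer.Tactic.RingSolver using (solve; solve-∀)
open import Data.Rational as ℚ
  using (ℚ; _+_; _*_; _-_; -_; _<_; 0ℚ; 1ℚ; Positive; toℚᵘ; fromℚᵘ)
import Data.Rational.Properties as ℚP
open import Data.Rational.Unnormalised as ℚᵘ using (ℚᵘ; mkℚᵘ; _≃_; *≡*; *<*)
import Data.Rational.Unnormalised.Properties as ℚᵘP
open import Data.Product using (_×_; _,_)
open import Data.List using (_∷_; [])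
open import Level using (0ℓ)
open import Function using (case_of_)
open import Function.Bundles using (_⇔_; mk⇔)
import Function.Properties.Equivalence as ⇔
open import Function.Related.Propositional using (module EquationalReasoning)
open import Relation.Binary.PropositionalEquality
open import Relation.Nullary.Decidable using (dec⇒maybe)
import Tactic.RingSolver as RingSolver
import Tactic.RingSolver.Core.AlmostCommutativeRing as ACR

ℚ-ring : ACR.AlmostCommutativeRing 0ℓ 0ℓ
ℚ-ring = ACR.fromCommutativeRing ℚP.+-*-commutativeRing (λ q → dec⇒maybe (0ℚ ℚ.≟ q))

fromℚᵘ-homo₂ : ∀ {_∙_ : ℚ → ℚ → ℚ} {_∙ᵘ_ : ℚᵘ → ℚᵘ → ℚᵘ} →
               (∀ p q → toℚᵘ (p ∙ q) ≃ toℚᵘ p ∙ᵘ toℚᵘ q) →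
               (∀ {p p′ q q′} → p ≃ p′ → q ≃ q′ → p ∙ᵘ q ≃ p′ ∙ᵘ q′) →
               ∀ p q → fromℚᵘ (p ∙ᵘ q) ≡ fromℚᵘ p ∙ fromℚᵘ q
fromℚᵘ-homo₂ {_∙_} {_∙ᵘ_} homo ∙ᵘ-cong p q = begin
  fromℚᵘ (p ∙ᵘ q)
    ≡⟨ ℚP.fromℚᵘ-cong (∙ᵘ-cong (ℚᵘP.≃-sym (ℚP.toℚᵘ-fromℚᵘ p)) (ℚᵘP.≃-sym (ℚP.toℚᵘ-fromℚᵘ q))) ⟩
  fromℚᵘ (toℚᵘ (fromℚᵘ p) ∙ᵘ toℚᵘ (fromℚᵘ q)) ≡⟨ ℚP.fromℚᵘ-cong (ℚᵘP.≃-sym (homo (fromℚᵘ p) (fromℚᵘ q))) ⟩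
  fromℚᵘ (toℚᵘ (fromℚᵘ p ∙ fromℚᵘ q))         ≡⟨ ℚP.fromℚᵘ-toℚᵘ _ ⟩
  fromℚᵘ p ∙ fromℚᵘ q                          ∎
  where open ≡-Reasoning

fromℚᵘ-homo-+ : ∀ p q → fromℚᵘ (p ℚᵘ.+ q) ≡ fromℚᵘ p + fromℚᵘ q
fromℚᵘ-homo-+ = fromℚᵘ-homo₂ ℚP.toℚᵘ-homo-+ ℚᵘP.+-cong

fromℚᵘ-homo-* : ∀ p q → fromℚᵘ (p ℚᵘ.* q) ≡ fromℚᵘ p * fromℚᵘ q
fromℚᵘ-homo-* = fromℚᵘ-homo₂ ℚP.toℚᵘ-homo-* ℚᵘP.*-cong

fromℚᵘ-homo‿- : ∀ p → fromℚᵘ (ℚᵘ.- p) ≡ - fromℚᵘ p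
fromℚᵘ-homo‿- p = begin
  fromℚᵘ (ℚᵘ.- p)                  ≡⟨ ℚP.fromℚᵘ-cong (ℚᵘP.-‿cong (ℚᵘP.≃-sym (ℚP.toℚᵘ-fromℚᵘ p))) ⟩
  fromℚᵘ (ℚᵘ.- toℚᵘ (fromℚᵘ p))    ≡⟨ ℚP.fromℚᵘ-cong (ℚᵘP.≃-sym (ℚP.toℚᵘ-homo‿- (fromℚᵘ p))) ⟩
  fromℚᵘ (toℚᵘ (- fromℚᵘ p))       ≡⟨ ℚP.fromℚᵘ-toℚᵘ _ ⟩
  - fromℚᵘ p                       ∎
  where open ≡-Reasoning

fromℚᵘ-mono-< : ∀ {p q} → p ℚᵘ.< q → fromℚᵘ p < fromℚᵘ q
fromℚᵘ-mono-< {p} {q} p<q = ℚP.toℚᵘ-cancel-<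
  (ℚᵘP.<-respˡ-≃ (ℚᵘP.≃-sym (ℚP.toℚᵘ-fromℚᵘ p)) (ℚᵘP.<-respʳ-≃ (ℚᵘP.≃-sym (ℚP.toℚᵘ-fromℚᵘ q)) p<q))

fromℚᵘ-cancel-< : ∀ {p q} → fromℚᵘ p < fromℚᵘ q → p ℚᵘ.< q
fromℚᵘ-cancel-< {p} {q} p<q =
  ℚᵘP.<-respˡ-≃ (ℚP.toℚᵘ-fromℚᵘ p) (ℚᵘP.<-respʳ-≃ (ℚP.toℚᵘ-fromℚᵘ q) (ℚP.toℚᵘ-mono-< p<q))

-- ι i is definitionally fromℚᵘ (mkℚᵘ i 0), and mkℚᵘ _ 0 commutes with _*_ and -_ on the nose.
ι-homo-+ : ∀ i j → ι (i ℤ.+ j) ≡ ι i + ι j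
ι-homo-+ i j = trans (ℚP.fromℚᵘ-cong {mkℚᵘ (i ℤ.+ j) 0} {mkℚᵘ i 0 ℚᵘ.+ mkℚᵘ j 0} (*≡* cross))
                     (fromℚᵘ-homo-+ (mkℚᵘ i 0) (mkℚᵘ j 0))
  where
  cross : (i ℤ.+ j) ℤ.* + 1 ≡ (i ℤ.* + 1 ℤ.+ j ℤ.* + 1) ℤ.* + 1
  cross = solve (i ∷ j ∷ [])

ι-homo-* : ∀ i j → ι (i ℤ.* j) ≡ ι i * ι j
ι-homo-* i j = fromℚᵘ-homo-* (mkℚᵘ i 0) (mkℚᵘ j 0)

ι-homo‿- : ∀ i → ι (ℤ.- i) ≡ - ι i
ι-homo‿- i = fromℚᵘ-homo‿- (mkℚᵘ i 0)

0<ι⇔0< : ∀ i → 0ℚ < ι i ⇔ + 0 ℤ.< i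
0<ι⇔0< i = mk⇔
  (λ 0<ιi → subst (+ 0 ℤ.<_) (ℤP.*-identityʳ i) (ℚᵘP.drop-*<* (fromℚᵘ-cancel-< {0ᵘ} {iᵘ} 0<ιi)))
  (λ 0<i → fromℚᵘ-mono-< {0ᵘ} {iᵘ} (*<* (subst (+ 0 ℤ.<_) (sym (ℤP.*-identityʳ i)) 0<i)))
  where
  0ᵘ iᵘ : ℚᵘ
  0ᵘ = mkℚᵘ (+ 0) 0
  iᵘ = mkℚᵘ i 0

0<r*q⇔0<q : ∀ r .{{_ : Positive r}} q → 0ℚ < r * q ⇔ 0ℚ < q
0<r*q⇔0<q r q = mk⇔
  (λ 0<rq → ℚP.*-cancelˡ-<-nonNeg r {{ℚP.pos⇒nonNeg r}} (subst (_< r * q) (sym (ℚP.*-zeroʳ r)) 0<rq))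
  (λ 0<q → subst (_< r * q) (ℚP.*-zeroʳ r) (ℚP.*-monoʳ-<-pos r 0<q))

0<k*[3-2k]⇔k≡1 : ∀ k → + 0 ℤ.< k ℤ.* (+ 3 ℤ.- + 2 ℤ.* k) ⇔ k ≡ + 1
0<k*[3-2k]⇔k≡1 k = mk⇔ (to k) λ { refl → ℤ.+<+ (ℕ.s≤s ℕ.z≤n) }
  where
  to : ∀ k → + 0 ℤ.< k ℤ.* (+ 3 ℤ.- + 2 ℤ.* k) → k ≡ + 1
  to (+ 0) (ℤ.+<+ ())
  to (+ 1) _ = refl
  -- For k ≥ 2 and k < 0 the right-hand side of expand (+ n) normalises to -[1+ _ ], so 0 < it is empty.
  to (+ suc (suc n)) 0<p = case subst (+ 0 ℤ.<_) (expand (+ n)) 0<p of λ ()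
    where
    expand : ∀ x → (+ 2 ℤ.+ x) ℤ.* (+ 3 ℤ.- + 2 ℤ.* (+ 2 ℤ.+ x)) ≡ ℤ.- ((+ 2 ℤ.+ x) ℤ.* (+ 1 ℤ.+ (x ℤ.+ x)))
    expand = solve-∀
  to -[1+ n ] 0<p = case subst (+ 0 ℤ.<_) (expand (+ n)) 0<p of λ ()
    where
    expand : ∀ x → ℤ.- (+ 1 ℤ.+ x) ℤ.* (+ 3 ℤ.- + 2 ℤ.* ℤ.- (+ 1 ℤ.+ x)) ≡ ℤ.- ((+ 1 ℤ.+ x) ℤ.* (+ 5 ℤ.+ (x ℤ.+ x)))
    expand = solve-∀

m*[i/[m*n]]≡i*[1/n] : ∀ i m n .{{_ : NonZero m}} .{{_ : NonZero n}} →
                      ι (+ m) * ((i ℚ./ (m ℕ.* n)) {{ℕP.m*n≢0 m n}}) ≡ ι i * (+ 1 ℚ./ n)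
m*[i/[m*n]]≡i*[1/n] i m@(suc _) n@(suc _) = begin
  ι (+ m) * (i ℚ./ (m ℕ.* n)) ≡⟨ fromℚᵘ-homo-* m/1 i/mn ⟨
  fromℚᵘ (m/1 ℚᵘ.* i/mn)      ≡⟨ ℚP.fromℚᵘ-cong {m/1 ℚᵘ.* i/mn} {i/1 ℚᵘ.* 1/n} (*≡* cross) ⟩
  fromℚᵘ (i/1 ℚᵘ.* 1/n)       ≡⟨ fromℚᵘ-homo-* i/1 1/n ⟩
  ι i * (+ 1 ℚ./ n)           ∎
  where
  open ≡-Reasoning
  m/1 i/mn i/1 1/n : ℚᵘ
  m/1  = mkℚᵘ (+ m) 0
  i/mn = mkℚᵘ i (ℕ.pred (m ℕ.* n))
  i/1  = mkℚᵘ i 0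
  1/n  = mkℚᵘ (+ 1) (ℕ.pred n)
  cross : (+ m ℤ.* i) ℤ.* + (1 ℕ.* n) ≡ (i ℤ.* + 1) ℤ.* + (1 ℕ.* (m ℕ.* n))
  cross rewrite ℕP.*-identityˡ n | ℕP.*-identityˡ (m ℕ.* n) | ℤP.pos-* m n = rearrange (+ m) (+ n) i
    where
    rearrange : ∀ a b c → (a ℤ.* c) ℤ.* b ≡ (c ℤ.* + 1) ℤ.* (a ℤ.* b)
    rearrange = solve-∀

2*[1-c]≡3*invM-1 : ∀ d .{{_ : NonZero d}} → ι (+ 2) * (1ℚ - c d) ≡ ι (+ 3) * invM-1 d
2*[1-c]≡3*invM-1 d = begin
  ι (+ 2) * (1ℚ - (1ℚ - h))              ≡⟨ cong (ι (+ 2) *_) (cancel 1ℚ h) ⟩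
  ι (+ 2) * h                            ≡⟨ cong (ι (+ 2) *_) (ℚP./-cong {+ 3} refl (ℕP.*-distribˡ-∸ 2 (M d) 1)) ⟨
  ι (+ 2) * (+ 3 ℚ./ (2 ℕ.* (M d ∸ 1)))  ≡⟨ m*[i/[m*n]]≡i*[1/n] (+ 3) 2 (M d ∸ 1) ⟩
  ι (+ 3) * invM-1 d                     ∎
  where
  open ≡-Reasoning
  instance
    _ = M-1-nonZero d
    _ = 2M-2-nonZero d
    _ = ℕP.m*n≢0 2 (M d ∸ 1)
  h : ℚ
  h = + 3 ℚ./ (2 ℕ.* M d ∸ 2)
  cancel : ∀ p q → p - (p - q) ≡ q
  cancel = RingSolver.solve-∀ ℚ-ring

-- x d t is definitionally curve d (ι t).
curve : (d : ℕ) → .{{NonZero d}} → ℚ → ℚ × ℚ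
curve d q = (invM-1 d * q , invM-1 d * (q * q * invM-1 d - q))

∇f·chord-curve : ∀ d .{{_ : NonZero d}} q r →
                 ι (+ 2) * (∇f d (curve d q) · (curve d (q + r) −ᵥ curve d q))
                 ≡ invM-1 d * invM-1 d * (r * (ι (+ 3) - ι (+ 2) * r))
∇f·chord-curve d q r = begin
  ι (+ 2) * (∇f d (curve d q) · (curve d (q + r) −ᵥ curve d q)) ≡⟨ expand a (c d) q r ⟩
  ι (+ 2) * (1ℚ - c d) * (r * a) - ι (+ 2) * (r * r) * (a * a)
    ≡⟨ cong (λ w → w * (r * a) - ι (+ 2) * (r * r) * (a * a)) (2*[1-c]≡3*invM-1 d) ⟩
  ι (+ 3) * a * (r * a) - ι (+ 2) * (r * r) * (a * a)            ≡⟨ collect a r ⟩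
  a * a * (r * (ι (+ 3) - ι (+ 2) * r))                          ∎
  where
  open ≡-Reasoning
  a : ℚ
  a = invM-1 d
  expand : ∀ α γ q r →
           ι (+ 2) * ((ι (+ 2) * (α * q) - γ) * (α * (q + r) - α * q)
                      + - 1ℚ * (α * ((q + r) * (q + r) * α - (q + r)) - α * (q * q * α - q)))
           ≡ ι (+ 2) * (1ℚ - γ) * (r * α) - ι (+ 2) * (r * r) * (α * α)
  expand = RingSolver.solve-∀ ℚ-ring
  collect : ∀ α r → ι (+ 3) * α * (r * α) - ι (+ 2) * (r * r) * (α * α) ≡ α * α * (r * (ι (+ 3) - ι (+ 2) * r))
  collect = RingSolver.solve-∀ ℚ-ring

∇f·chord : ∀ d .{{_ : NonZero d}} t k →
           ι (+ 2) * (∇f d (x d t) · (x d (t ℤ.+ k) −ᵥ x d t))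
           ≡ invM-1 d * invM-1 d * ι (k ℤ.* (+ 3 ℤ.- + 2 ℤ.* k))
∇f·chord d t k = begin
  ι (+ 2) * (∇f d (x d t) · (x d (t ℤ.+ k) −ᵥ x d t))
    ≡⟨ cong (λ y → ι (+ 2) * (∇f d (x d t) · (y −ᵥ x d t))) (cong (curve d) (ι-homo-+ t k)) ⟩
  ι (+ 2) * (∇f d (curve d (ι t)) · (curve d (ι t + ι k) −ᵥ curve d (ι t)))
    ≡⟨ ∇f·chord-curve d (ι t) (ι k) ⟩
  invM-1 d * invM-1 d * (ι k * (ι (+ 3) - ι (+ 2) * ι k))
    ≡⟨ cong (invM-1 d * invM-1 d *_) ι-k*[3-2k] ⟨
  invM-1 d * invM-1 d * ι (k ℤ.* (+ 3 ℤ.- + 2 ℤ.* k)) ∎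
  where
  open ≡-Reasoning
  ι-k*[3-2k] : ι (k ℤ.* (+ 3 ℤ.- + 2 ℤ.* k)) ≡ ι k * (ι (+ 3) - ι (+ 2) * ι k)
  ι-k*[3-2k] = begin
    ι (k ℤ.* (+ 3 ℤ.- + 2 ℤ.* k))               ≡⟨ ι-homo-* k (+ 3 ℤ.- + 2 ℤ.* k) ⟩
    ι k * ι (+ 3 ℤ.- + 2 ℤ.* k)                 ≡⟨ cong (ι k *_) (ι-homo-+ (+ 3) (ℤ.- (+ 2 ℤ.* k))) ⟩
    ι k * (ι (+ 3) + ι (ℤ.- (+ 2 ℤ.* k)))       ≡⟨ cong (λ y → ι k * (ι (+ 3) + y)) (ι-homo‿- (+ 2 ℤ.* k)) ⟩
    ι k * (ι (+ 3) - ι (+ 2 ℤ.* k))             ≡⟨ cong (λ y → ι k * (ι (+ 3) - y)) (ι-homo-* (+ 2) k) ⟩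
    ι k * (ι (+ 3) - ι (+ 2) * ι k)             ∎

invM-1-pos : ∀ d .{{_ : NonZero d}} → Positive (invM-1 d)
invM-1-pos d = ℚP.normalize-pos 1 (M d ∸ 1) {{M-1-nonZero d}}

lemma3p8 : (d : ℕ) → .{{_ : NonZero d}} → 2 ∣ d →
    (t : ℕ) → t ℕ.≤ M d ∸ 2 → (k : ℤ) →
    + 0 ℤ.≤ + t ℤ.+ k → + t ℤ.+ k ℤ.≤ + (M d ∸ 1) →
    Improving d (x d (+ t)) (x d (+ t ℤ.+ k) −ᵥ x d (+ t)) ⇔ (k ≡ + 1)
lemma3p8 d _ t _ k _ _ = begin
  0ℚ < ∇f d (x d (+ t)) · (x d (+ t ℤ.+ k) −ᵥ x d (+ t))
    ∼⟨ ⇔.sym (0<r*q⇔0<q (ι (+ 2)) _) ⟩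
  0ℚ < ι (+ 2) * (∇f d (x d (+ t)) · (x d (+ t ℤ.+ k) −ᵥ x d (+ t)))
    ≡⟨ cong (0ℚ <_) (∇f·chord d (+ t) k) ⟩
  0ℚ < invM-1 d * invM-1 d * ι (k ℤ.* (+ 3 ℤ.- + 2 ℤ.* k))
    ∼⟨ 0<r*q⇔0<q (invM-1 d * invM-1 d) _ ⟩
  0ℚ < ι (k ℤ.* (+ 3 ℤ.- + 2 ℤ.* k))
    ∼⟨ 0<ι⇔0< (k ℤ.* (+ 3 ℤ.- + 2 ℤ.* k)) ⟩
  + 0 ℤ.< k ℤ.* (+ 3 ℤ.- + 2 ℤ.* k)
    ∼⟨ 0<k*[3-2k]⇔k≡1 k ⟩
  k ≡ + 1 ∎
  where
  open EquationalReasoning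
  instance
    _ = invM-1-pos d
    _ = ℚP.pos*pos⇒pos (invM-1 d) (invM-1 d)
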